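{- Let $n \in \{1,2\}$. For every $c \in \mathbb{N}$ and every real $\epsilon > 0$ there exists $k \in \mathbb{N}$ such that $P[A^{n}_{k,c}] > 1 - \epsilon$, where $A^{n}_{k,c}$ is the event that the drunk angel of power $c$ on the $n$-dimensional infinite grid is caged when the hiding devil plays the Gauss's circle strategy with inner radius $k$.
   Context: The $n$-dimensional infinite grid has vertex set $\mathbb{Z}^n$. For $x=(x_1,\dots,x_n)$ let $\|x\| = \max_i |x_i|$ and $d(x,y)=\|x-y\|$. The lattice sphere of radius $r$ is $L^n_r = \{x \in \mathbb{Z}^n : \|x\| \le r\}$, and the hollow lattice sphere of inner radius $k$ and thickness $c$ is $H^n_{k,c} = L^n_{k+c} \setminus L^n_{k-1}$. The drunk angel of power $c$ starts at the origin and in each turn moves from her current vertex $x$ to each vertex $y$ with $d(x,y)\le c$ with probability $\frac{1}{(2c+1)^n}$, independently of previous turns (so her position is a sum of i.i.d. steps uniform on $\{ -c,\dots,c\}^n$). Gauss's circle strategy: the hiding devil secretly destroys one vertex per turn for $N = |H^n_{k,c}|$ turns, building the closed shape $H^n_{k,c}$; destroyed vertices do not affect the angel's moves. After the angel's $N$-th move the devil reveals $H^n_{k,c}$, and $A^n_{k,c}$ is the event that the angel's position then lies in the inner part of $H^n_{k,c}$ (the region it encloses, i.e. points at distance less than $k$ from the origin).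
   Formalization: The parameter ε ranges over the positive rationals instead of the positive reals. -}

module Defs where

open import Data.Nat as ℕ using (ℕ; zero; suc; _⊔_; _<ᵇ_; _≤ᵇ_)
open import Data.Nat.Properties using (m^n≢0)
open import Data.Integer as ℤ using (ℤ; +_; ∣_∣)
open import Data.Rational as ℚ using (ℚ)
open import Data.List using (List; []; _∷_; map; concatMap; upTo; filter; length; foldr)
open import Data.Vec as Vec using (Vec; []; _∷_; zipWith; replicate)
open import Relation.Nullary.Decidable using (does)
open import Data.Bool using (Bool; T)
open import Relation.Unary using (Decidable)

Vertex : ℕ → Set
Vertex n = Vec ℤ n

‖_‖ : ∀ {n} → Vertex n → ℕ
‖ x ‖ = Vec.foldr _ (λ a m → ∣ a ∣ ⊔ m) 0 x

_⊕_ : ∀ {n} → Vertex n → Vertex n → Vertex n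
_⊕_ = zipWith ℤ._+_

origin : ∀ {n} → Vertex n
origin = replicate _ (+ 0)

range : ℕ → List ℤ
range r = map (λ i → (+ i) ℤ.- (+ r)) (upTo (suc (r ℕ.+ r)))

-- Lattice sphere L^n_r = {x ∈ ℤ^n : ‖x‖ ≤ r}, as a duplicate-free list.
L : (n r : ℕ) → List (Vertex n)
L zero    r = [] ∷ []
L (suc n) r = concatMap (λ a → map (a ∷_) (L n r)) (range r)

-- Hollow lattice sphere H^n_{k,c} = L^n_{k+c} \ L^n_{k-1}
-- (points x with k ≤ ‖x‖ ≤ k + c; for k = 0, L_{-1} = ∅).
H : (n k c : ℕ) → List (Vertex n)
H n k c = filter (λ x → T? (k ≤ᵇ ‖ x ‖)) (L n (k ℕ.+ c))
  where
  open import Data.Bool.Properties using () renaming (T? to T?)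

-- N = |H^n_{k,c}|, the number of turns the devil needs.
N : (n k c : ℕ) → ℕ
N n k c = length (H n k c)

-- All sequences of m steps of the drunk angel of power c in ℤ^n;
-- each step is uniform on {-c,…,c}^n = L^n_c, so every sequence has
-- probability 1 / (2c+1)^(n m).
stepSeqs : (n c m : ℕ) → List (List (Vertex n))
stepSeqs n c zero    = [] ∷ []
stepSeqs n c (suc m) = concatMap (λ s → map (s ∷_) (stepSeqs n c m)) (L n c)

position : ∀ {n} → List (Vertex n) → Vertex n
position = foldr _⊕_ origin

inner? : ∀ {n} (k : ℕ) → Vertex n → Bool
inner? k x = ‖ x ‖ <ᵇ k

-- Number of step sequences of length N for which A^n_{k,c} holds
-- (the angel's position after her N-th move is in the inner part).
countA : (n k c : ℕ) → ℕ
countA n k c =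
  length (filter (λ seq → T? (inner? k (position seq))) (stepSeqs n c (N n k c)))
  where
  open import Data.Bool.Properties using () renaming (T? to T?)

ProbA : (n k c : ℕ) → ℚ
ProbA n k c =
  ℚ._/_ (+ countA n k c) ((suc (c ℕ.+ c)) ℕ.^ (n ℕ.* N n k c))
        {{m^n≢0 (suc (c ℕ.+ c)) (n ℕ.* N n k c)}}

-- The argument is a second-moment bound, carried out by counting walks. A step s, uniform on
-- L^n_c, has mean zero, so each move adds on average E‖s‖₂² ≤ n c² to the squared Euclidean
-- length of the angel's position; after m moves its average is at most m n c². An angel that is
-- not caged has ‖x‖₂² ≥ ‖x‖² ≥ k², so by Markov's inequality P[not A] ≤ m n c² / k². The devil
-- needs m = |H^n_{k,c}| moves, and for n ≤ 2 this is O(k), so P[not A] = O(1/k).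

module Submission where

open import Defs
open import Data.Nat using (ℕ)
open import Data.Rational using (ℚ; 0ℚ; 1ℚ; _-_; _<_)
open import Data.Product using (∃-syntax)
open import Data.Sum using (_⊎_)
open import Relation.Binary.PropositionalEquality using (_≡_)

open import Level using (0ℓ)
open import Algebra.Bundles using (CommutativeSemiring)
import Algebra.Properties.CommutativeSemigroup as CommutativeSemigroupProperties
open import Data.List using (List; []; _∷_; _++_; map; concatMap)

-- Finite sums over lists

module FiniteSum (R : CommutativeSemiring 0ℓ 0ℓ) where
  open CommutativeSemiring R
  open CommutativeSemigroupProperties +-commutativeSemigroup using (interchange)
  open import Relation.Binary.Reasoning.Setoid setoid

  ∑ : {A : Set} → (A → Carrier) → List A → Carrier
  ∑ f []       = 0#
  ∑ f (x ∷ xs) = f x + ∑ f xs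

  module _ {A : Set} where

    ∑-cong : {f g : A → Carrier} → (∀ x → f x ≈ g x) → ∀ xs → ∑ f xs ≈ ∑ g xs
    ∑-cong f≈g []       = refl
    ∑-cong f≈g (x ∷ xs) = +-cong (f≈g x) (∑-cong f≈g xs)

    ∑-++ : ∀ (f : A → Carrier) xs ys → ∑ f (xs ++ ys) ≈ ∑ f xs + ∑ f ys
    ∑-++ f []       ys = sym (+-identityˡ _)
    ∑-++ f (x ∷ xs) ys = begin
      f x + ∑ f (xs ++ ys)        ≈⟨ +-congˡ (∑-++ f xs ys) ⟩
      f x + (∑ f xs + ∑ f ys)     ≈⟨ sym (+-assoc _ _ _) ⟩
      f x + ∑ f xs + ∑ f ys       ∎

    ∑-zero : ∀ xs → ∑ {A} (λ _ → 0#) xs ≈ 0#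
    ∑-zero []       = refl
    ∑-zero (x ∷ xs) = trans (+-identityˡ _) (∑-zero xs)

    ∑-distrib-+ : ∀ (f g : A → Carrier) xs → ∑ (λ x → f x + g x) xs ≈ ∑ f xs + ∑ g xs
    ∑-distrib-+ f g []       = sym (+-identityˡ _)
    ∑-distrib-+ f g (x ∷ xs) = begin
      f x + g x + ∑ (λ x → f x + g x) xs  ≈⟨ +-congˡ (∑-distrib-+ f g xs) ⟩
      f x + g x + (∑ f xs + ∑ g xs)       ≈⟨ interchange _ _ _ _ ⟩
      f x + ∑ f xs + (g x + ∑ g xs)       ∎

    ∑-distribˡ-* : ∀ c (f : A → Carrier) xs → c * ∑ f xs ≈ ∑ (λ x → c * f x) xs
    ∑-distribˡ-* c f []       = zeroʳ c
    ∑-distribˡ-* c f (x ∷ xs) = trans (distribˡ c _ _) (+-congˡ (∑-distribˡ-* c f xs))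

    ∑-distribʳ-* : ∀ c (f : A → Carrier) xs → ∑ f xs * c ≈ ∑ (λ x → f x * c) xs
    ∑-distribʳ-* c f []       = zeroˡ c
    ∑-distribʳ-* c f (x ∷ xs) = trans (distribʳ c _ _) (+-congˡ (∑-distribʳ-* c f xs))

  module _ {A B : Set} where

    ∑-map : ∀ (f : B → Carrier) (g : A → B) xs → ∑ f (map g xs) ≈ ∑ (λ x → f (g x)) xs
    ∑-map f g []       = refl
    ∑-map f g (x ∷ xs) = +-congˡ (∑-map f g xs)

    ∑-concatMap : ∀ (f : B → Carrier) (g : A → List B) xs →
                  ∑ f (concatMap g xs) ≈ ∑ (λ x → ∑ f (g x)) xs
    ∑-concatMap f g []       = refl
    ∑-concatMap f g (x ∷ xs) =
      trans (∑-++ f (g x) (concatMap g xs)) (+-congˡ (∑-concatMap f g xs))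

    ∑-comm : ∀ (f : A → B → Carrier) xs ys →
             ∑ (λ x → ∑ (f x) ys) xs ≈ ∑ (λ y → ∑ (λ x → f x y) xs) ys
    ∑-comm f []       ys = sym (∑-zero ys)
    ∑-comm f (x ∷ xs) ys = trans (+-congˡ (∑-comm f xs ys)) (sym (∑-distrib-+ (f x) _ ys))

  ∑-pairs : ∀ {A B C : Set} (f : C → Carrier) (g : A → B → C) xs ys →
            ∑ f (concatMap (λ x → map (g x) ys) xs) ≈ ∑ (λ x → ∑ (λ y → f (g x y)) ys) xs
  ∑-pairs f g xs ys = trans (∑-concatMap f _ xs) (∑-cong (λ x → ∑-map f (g x) ys) xs)

open import Data.Bool using (Bool; true; false; T)
open import Data.Bool.Properties using (T?)
open import Data.Nat using (zero; suc; _+_; _*_; _≤_; _^_; _≤ᵇ_; _⊔_; z≤n; s≤s)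
import Data.Nat as ℕ
import Data.Nat.Properties as ℕₚ
import Data.Nat.Tactic.RingSolver as ℕ-Solver
open import Data.Integer as ℤ using (ℤ; +_; -[1+_]; +[1+_]; ∣_∣)
import Data.Integer.Properties as ℤₚ
open import Data.Integer.Tactic.RingSolver using (solve-∀)
open import Data.Rational as ℚ using (mkℚ; _/_; toℚᵘ)
import Data.Rational.Properties as ℚₚ
open import Data.Rational.Unnormalised as ℚᵘ using (mkℚᵘ)
import Data.Rational.Unnormalised.Properties as ℚᵘₚ
open import Data.Nat.Coprimality using (Coprime)
open import Data.List using (_∷ʳ_; length; filter; upTo; applyUpTo)
import Data.List.Properties as List
open import Data.List.Relation.Unary.All as All using (All; []; _∷_)
import Data.List.Relation.Unary.All.Properties as All
open import Data.Vec using ([]; _∷_)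
open import Data.Product using (_,_)
open import Data.Sum using (inj₁; inj₂)
open import Relation.Nullary using (contradiction)
open import Relation.Binary.PropositionalEquality
  using (refl; sym; trans; cong; cong₂; subst; subst₂; module ≡-Reasoning)

open FiniteSum ℕₚ.+-*-commutativeSemiring
module ℤ∑ = FiniteSum ℤₚ.+-*-commutativeSemiring

module _ {A : Set} where

  ∑-const : ∀ c (xs : List A) → ∑ (λ _ → c) xs ≡ length xs * c
  ∑-const c []       = refl
  ∑-const c (x ∷ xs) = cong (_+_ c) (∑-const c xs)

  ∑-mono : ∀ {f g : A → ℕ} {xs} → All (λ x → f x ≤ g x) xs → ∑ f xs ≤ ∑ g xs
  ∑-mono []           = z≤n
  ∑-mono (fx≤gx ∷ fs) = ℕₚ.+-mono-≤ fx≤gx (∑-mono fs)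

  pos-∑ : ∀ (f : A → ℕ) xs → + ∑ f xs ≡ ℤ∑.∑ (λ x → + f x) xs
  pos-∑ f []       = refl
  pos-∑ f (x ∷ xs) = trans (ℤₚ.pos-+ (f x) (∑ f xs)) (cong (ℤ._+_ (+ f x)) (pos-∑ f xs))

length-pairs : ∀ {A B C : Set} (g : A → B → C) xs ys →
               length (concatMap (λ x → map (g x) ys) xs) ≡ length xs * length ys
length-pairs g xs ys = begin
  length zs                     ≡⟨ ℕₚ.*-identityʳ _ ⟨
  length zs * 1                 ≡⟨ ∑-const 1 zs ⟨
  ∑ (λ _ → 1) zs                ≡⟨ ∑-pairs (λ _ → 1) g xs ys ⟩
  ∑ (λ _ → ∑ (λ _ → 1) ys) xs   ≡⟨ ∑-const _ xs ⟩
  length xs * ∑ (λ _ → 1) ys    ≡⟨ cong (length xs *_) (trans (∑-const 1 ys) (ℕₚ.*-identityʳ _)) ⟩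
  length xs * length ys         ∎
  where
  open ≡-Reasoning
  zs = concatMap (λ x → map (g x) ys) xs

-- Counting

𝟙 : Bool → ℕ
𝟙 true  = 1
𝟙 false = 0

count : ∀ {A : Set} → (A → Bool) → List A → ℕ
count p = ∑ (λ x → 𝟙 (p x))

module _ {A : Set} (p : A → Bool) where

  length-filter : ∀ xs → length (filter (λ x → T? (p x)) xs) ≡ count p xs
  length-filter []       = refl
  length-filter (x ∷ xs) with p x
  ... | true  = cong suc (length-filter xs)
  ... | false = length-filter xs

  markov : ∀ (F : A → ℕ) K → (∀ x → p x ≡ false → K ≤ F x) → ∀ xs →
           K * length xs ≤ K * count p xs + ∑ F xs
  markov F K outside⇒K≤F xs = begin
    K * length xs                     ≡⟨ ℕₚ.*-comm K _ ⟩
    length xs * K                     ≡⟨ ∑-const K xs ⟨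
    ∑ (λ _ → K) xs                    ≤⟨ ∑-mono (All.universal K≤ xs) ⟩
    ∑ (λ x → K * 𝟙 (p x) + F x) xs    ≡⟨ ∑-distrib-+ _ F xs ⟩
    ∑ (λ x → K * 𝟙 (p x)) xs + ∑ F xs ≡⟨ cong (_+ ∑ F xs) (∑-distribˡ-* K _ xs) ⟨
    K * count p xs + ∑ F xs           ∎
    where
    open ℕₚ.≤-Reasoning
    K≤ : ∀ x → K ≤ K * 𝟙 (p x) + F x
    K≤ x with p x in eq
    ... | true  = ℕₚ.≤-trans (ℕₚ.≤-reflexive (sym (ℕₚ.*-identityʳ K))) (ℕₚ.m≤m+n _ _)
    ... | false = ℕₚ.≤-trans (outside⇒K≤F x eq) (ℕₚ.m≤n+m _ _)

-- Lattice spheres and walks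

range-suc : ∀ r → range (suc r) ≡ -[1+ r ] ∷ range r ∷ʳ + suc r
range-suc r = cong (-[1+ r ] ∷_) (begin
  map (shift (suc r)) (applyUpTo suc (suc (r + suc r)))
    ≡⟨ cong (λ m → map (shift (suc r)) (applyUpTo suc (suc m))) (ℕₚ.+-suc r r) ⟩
  map (shift (suc r)) (applyUpTo suc (suc m))
    ≡⟨ cong (map (shift (suc r))) (List.applyUpTo-∷ʳ suc m) ⟨
  map (shift (suc r)) (applyUpTo suc m ∷ʳ suc m)
    ≡⟨ List.map-++ (shift (suc r)) (applyUpTo suc m) _ ⟩
  map (shift (suc r)) (applyUpTo suc m) ∷ʳ shift (suc r) (suc m)
    ≡⟨ cong₂ _∷ʳ_ shifted top ⟩
  range r ∷ʳ + suc r ∎)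
  where
  open ≡-Reasoning
  m = suc (r + r)
  shift : ℕ → ℕ → ℤ
  shift t i = + i ℤ.- + t
  shift-suc : ∀ i → shift (suc r) (suc i) ≡ shift r i
  shift-suc i = trans (ℤₚ.[1+m]⊖[1+n]≡m⊖n i r) (sym (ℤₚ.m-n≡m⊖n i r))
  shifted : map (shift (suc r)) (applyUpTo suc m) ≡ range r
  shifted = begin
    map (shift (suc r)) (applyUpTo suc m)
      ≡⟨ cong (map (shift (suc r))) (List.map-applyUpTo (λ i → i) suc m) ⟨
    map (shift (suc r)) (map suc (upTo m))
      ≡⟨ List.map-∘ (upTo m) ⟨
    map (λ i → shift (suc r) (suc i)) (upTo m)
      ≡⟨ List.map-cong shift-suc (upTo m) ⟩
    range r ∎
  top : shift (suc r) (suc m) ≡ + suc r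
  top = trans (ℤₚ.⊖-≥ (s≤s (ℕₚ.m≤n+m r (suc r)))) (cong +_ (ℕₚ.m+n∸n≡m (suc r) r))

length-range : ∀ r → length (range r) ≡ suc (r + r)
length-range r = trans (List.length-map _ (upTo (suc (r + r))))
                        (List.length-applyUpTo (λ i → i) (suc (r + r)))

range-bounded : ∀ r → All (λ a → ∣ a ∣ ≤ r) (range r)
range-bounded zero    = z≤n ∷ []
range-bounded (suc r) rewrite range-suc r =
  ℕₚ.≤-refl ∷ All.∷ʳ⁺ (All.map ℕₚ.m≤n⇒m≤1+n (range-bounded r)) ℕₚ.≤-refl

length-L : ∀ n r → length (L n r) ≡ suc (r + r) ^ n
length-L zero    r = refl
length-L (suc n) r =
  trans (length-pairs _∷_ (range r) (L n r)) (cong₂ _*_ (length-range r) (length-L n r))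

length-stepSeqs : ∀ n c m → length (stepSeqs n c m) ≡ suc (c + c) ^ (n * m)
length-stepSeqs n c m = trans (length≡ m) (ℕₚ.^-*-assoc (suc (c + c)) n m)
  where
  length≡ : ∀ m → length (stepSeqs n c m) ≡ (suc (c + c) ^ n) ^ m
  length≡ zero    = refl
  length≡ (suc m) =
    trans (length-pairs _∷_ (L n c) (stepSeqs n c m)) (cong₂ _*_ (length-L n c) (length≡ m))

-- Second moment of the walk

⟪_,_⟫ : ∀ {n} → Vertex n → Vertex n → ℤ
⟪ []    , []    ⟫ = + 0
⟪ a ∷ x , b ∷ y ⟫ = a ℤ.* b ℤ.+ ⟪ x , y ⟫

‖_‖₂² : ∀ {n} → Vertex n → ℕ
‖ []    ‖₂² = 0
‖ a ∷ x ‖₂² = ∣ a ∣ * ∣ a ∣ + ‖ x ‖₂²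

pos-‖‖₂² : ∀ {n} (x : Vertex n) → + ‖ x ‖₂² ≡ ⟪ x , x ⟫
pos-‖‖₂² []      = refl
pos-‖‖₂² (a ∷ x) = trans (ℤₚ.pos-+ (∣ a ∣ * ∣ a ∣) ‖ x ‖₂²) (cong₂ ℤ._+_ (pos-∣a∣² a) (pos-‖‖₂² x))
  where
  pos-∣a∣² : ∀ a → + (∣ a ∣ * ∣ a ∣) ≡ a ℤ.* a
  pos-∣a∣² (+ n)    = ℤₚ.pos-* n n
  pos-∣a∣² -[1+ n ] = refl

⟪⊕,⊕⟫ : ∀ {n} (x y : Vertex n) → ⟪ x ⊕ y , x ⊕ y ⟫ ≡ ⟪ x , x ⟫ ℤ.+ ⟪ y , y ⟫ ℤ.+ + 2 ℤ.* ⟪ x , y ⟫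
⟪⊕,⊕⟫ []      []      = refl
⟪⊕,⊕⟫ (a ∷ x) (b ∷ y) = trans (cong (ℤ._+_ ((a ℤ.+ b) ℤ.* (a ℤ.+ b))) (⟪⊕,⊕⟫ x y))
                               (expand a b ⟪ x , x ⟫ ⟪ y , y ⟫ ⟪ x , y ⟫)
  where
  expand : ∀ a b X Y Z → (a ℤ.+ b) ℤ.* (a ℤ.+ b) ℤ.+ (X ℤ.+ Y ℤ.+ + 2 ℤ.* Z)
           ≡ a ℤ.* a ℤ.+ X ℤ.+ (b ℤ.* b ℤ.+ Y) ℤ.+ + 2 ℤ.* (a ℤ.* b ℤ.+ Z)
  expand = solve-∀

‖‖²≤‖‖₂² : ∀ {n} (x : Vertex n) → ‖ x ‖ * ‖ x ‖ ≤ ‖ x ‖₂²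
‖‖²≤‖‖₂² []      = z≤n
‖‖²≤‖‖₂² (a ∷ x) with ℕₚ.≤-total ∣ a ∣ ‖ x ‖
... | inj₁ ∣a∣≤‖x‖ rewrite ℕₚ.m≤n⇒m⊔n≡n ∣a∣≤‖x‖ = ℕₚ.≤-trans (‖‖²≤‖‖₂² x) (ℕₚ.m≤n+m _ _)
... | inj₂ ‖x‖≤∣a∣ rewrite ℕₚ.m≥n⇒m⊔n≡m ‖x‖≤∣a∣ = ℕₚ.m≤m+n _ _

∑-range : ∀ r → ℤ∑.∑ (λ a → a) (range r) ≡ + 0
∑-range zero    = refl
∑-range (suc r) = begin
  ℤ∑.∑ (λ a → a) (range (suc r))
    ≡⟨ cong (ℤ∑.∑ (λ a → a)) (range-suc r) ⟩
  -[1+ r ] ℤ.+ ℤ∑.∑ (λ a → a) (range r ∷ʳ + suc r)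
    ≡⟨ cong (ℤ._+_ -[1+ r ]) (ℤ∑.∑-++ (λ a → a) (range r) (+ suc r ∷ [])) ⟩
  -[1+ r ] ℤ.+ (ℤ∑.∑ (λ a → a) (range r) ℤ.+ (+ suc r ℤ.+ + 0))
    ≡⟨ cong (λ s → -[1+ r ] ℤ.+ (s ℤ.+ (+ suc r ℤ.+ + 0))) (∑-range r) ⟩
  -[1+ r ] ℤ.+ (+ 0 ℤ.+ (+ suc r ℤ.+ + 0))
    ≡⟨ cong (ℤ._+_ -[1+ r ]) (trans (ℤₚ.+-identityˡ (+ suc r ℤ.+ + 0)) (ℤₚ.+-identityʳ (+ suc r))) ⟩
  -[1+ r ] ℤ.+ + suc r
    ≡⟨ ℤₚ.+-inverseˡ (+ suc r) ⟩
  + 0 ∎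
  where open ≡-Reasoning

∑⟪L,p⟫≡0 : ∀ n c (p : Vertex n) → ℤ∑.∑ (λ s → ⟪ s , p ⟫) (L n c) ≡ + 0
∑⟪L,p⟫≡0 zero    c []      = refl
∑⟪L,p⟫≡0 (suc n) c (b ∷ p) = begin
  ℤ∑.∑ (λ s → ⟪ s , b ∷ p ⟫) (L (suc n) c)
    ≡⟨ ℤ∑.∑-pairs (λ s → ⟪ s , b ∷ p ⟫) _∷_ (range c) (L n c) ⟩
  ℤ∑.∑ (λ a → ℤ∑.∑ (λ s → a ℤ.* b ℤ.+ ⟪ s , p ⟫) (L n c)) (range c)
    ≡⟨ ℤ∑.∑-cong (λ a → ℤ∑.∑-distrib-+ (λ _ → a ℤ.* b) _ (L n c)) (range c) ⟩
  ℤ∑.∑ (λ a → ℤ∑.∑ (λ _ → a ℤ.* b) (L n c) ℤ.+ ℤ∑.∑ (λ s → ⟪ s , p ⟫) (L n c)) (range c)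
    ≡⟨ ℤ∑.∑-cong (λ a → trans (cong (ℤ._+_ (ℤ∑.∑ (λ _ → a ℤ.* b) (L n c))) (∑⟪L,p⟫≡0 n c p))
                              (ℤₚ.+-identityʳ (ℤ∑.∑ (λ _ → a ℤ.* b) (L n c)))) (range c) ⟩
  ℤ∑.∑ (λ a → ℤ∑.∑ (λ _ → a ℤ.* b) (L n c)) (range c)
    ≡⟨ ℤ∑.∑-comm (λ a _ → a ℤ.* b) (range c) (L n c) ⟩
  ℤ∑.∑ (λ _ → ℤ∑.∑ (λ a → a ℤ.* b) (range c)) (L n c)
    ≡⟨ ℤ∑.∑-cong (λ _ → sym (ℤ∑.∑-distribʳ-* b (λ a → a) (range c))) (L n c) ⟩
  ℤ∑.∑ (λ _ → ℤ∑.∑ (λ a → a) (range c) ℤ.* b) (L n c)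
    ≡⟨ ℤ∑.∑-cong (λ _ → cong (ℤ._* b) (∑-range c)) (L n c) ⟩
  ℤ∑.∑ (λ _ → + 0) (L n c)
    ≡⟨ ℤ∑.∑-zero (L n c) ⟩
  + 0 ∎
  where open ≡-Reasoning

∑‖s⊕p‖₂² : ∀ n c (p : Vertex n) →
           ∑ (λ s → ‖ s ⊕ p ‖₂²) (L n c) ≡ ∑ ‖_‖₂² (L n c) + length (L n c) * ‖ p ‖₂²
∑‖s⊕p‖₂² n c p = ℤₚ.+-injective (begin
  + ∑ (λ s → ‖ s ⊕ p ‖₂²) Lc
    ≡⟨ pos-∑ _ Lc ⟩
  ℤ∑.∑ (λ s → + ‖ s ⊕ p ‖₂²) Lc
    ≡⟨ ℤ∑.∑-cong expand Lc ⟩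
  ℤ∑.∑ (λ s → + (‖ s ‖₂² + ‖ p ‖₂²) ℤ.+ + 2 ℤ.* ⟪ s , p ⟫) Lc
    ≡⟨ ℤ∑.∑-distrib-+ _ _ Lc ⟩
  ℤ∑.∑ (λ s → + (‖ s ‖₂² + ‖ p ‖₂²)) Lc ℤ.+ ℤ∑.∑ (λ s → + 2 ℤ.* ⟪ s , p ⟫) Lc
    ≡⟨ cong (ℤ._+_ Σ₀) (ℤ∑.∑-distribˡ-* (+ 2) (λ s → ⟪ s , p ⟫) Lc) ⟨
  ℤ∑.∑ (λ s → + (‖ s ‖₂² + ‖ p ‖₂²)) Lc ℤ.+ + 2 ℤ.* ℤ∑.∑ (λ s → ⟪ s , p ⟫) Lc
    ≡⟨ cong (λ z → Σ₀ ℤ.+ + 2 ℤ.* z) (∑⟪L,p⟫≡0 n c p) ⟩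
  ℤ∑.∑ (λ s → + (‖ s ‖₂² + ‖ p ‖₂²)) Lc ℤ.+ + 0
    ≡⟨ ℤₚ.+-identityʳ Σ₀ ⟩
  ℤ∑.∑ (λ s → + (‖ s ‖₂² + ‖ p ‖₂²)) Lc
    ≡⟨ pos-∑ _ Lc ⟨
  + ∑ (λ s → ‖ s ‖₂² + ‖ p ‖₂²) Lc
    ≡⟨ cong +_ (trans (∑-distrib-+ ‖_‖₂² _ Lc) (cong (_+_ (∑ ‖_‖₂² Lc)) (∑-const _ Lc))) ⟩
  + (∑ ‖_‖₂² Lc + length Lc * ‖ p ‖₂²) ∎)
  where
  open ≡-Reasoning
  Lc = L n c
  Σ₀ = ℤ∑.∑ (λ s → + (‖ s ‖₂² + ‖ p ‖₂²)) Lc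
  expand : ∀ s → + ‖ s ⊕ p ‖₂² ≡ + (‖ s ‖₂² + ‖ p ‖₂²) ℤ.+ + 2 ℤ.* ⟪ s , p ⟫
  expand s = begin
    + ‖ s ⊕ p ‖₂²
      ≡⟨ pos-‖‖₂² (s ⊕ p) ⟩
    ⟪ s ⊕ p , s ⊕ p ⟫
      ≡⟨ ⟪⊕,⊕⟫ s p ⟩
    ⟪ s , s ⟫ ℤ.+ ⟪ p , p ⟫ ℤ.+ cross
      ≡⟨ cong (ℤ._+ cross) (cong₂ ℤ._+_ (pos-‖‖₂² s) (pos-‖‖₂² p)) ⟨
    + ‖ s ‖₂² ℤ.+ + ‖ p ‖₂² ℤ.+ cross
      ≡⟨ cong (ℤ._+ cross) (ℤₚ.pos-+ ‖ s ‖₂² ‖ p ‖₂²) ⟨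
    + (‖ s ‖₂² + ‖ p ‖₂²) ℤ.+ cross ∎
    where cross = + 2 ℤ.* ⟪ s , p ⟫

∑‖L‖₂²≤ : ∀ n c → ∑ ‖_‖₂² (L n c) ≤ length (L n c) * (n * (c * c))
∑‖L‖₂²≤ zero    c = z≤n
∑‖L‖₂²≤ (suc n) c = begin
  ∑ ‖_‖₂² (L (suc n) c)
    ≡⟨ ∑-pairs ‖_‖₂² _∷_ (range c) (L n c) ⟩
  ∑ (λ a → ∑ (λ s → ∣ a ∣ * ∣ a ∣ + ‖ s ‖₂²) (L n c)) (range c)
    ≡⟨ ∑-cong (λ a → trans (∑-distrib-+ _ ‖_‖₂² (L n c)) (cong (_+ _) (∑-const _ (L n c))))
              (range c) ⟩
  ∑ (λ a → ℓ * (∣ a ∣ * ∣ a ∣) + ∑ ‖_‖₂² (L n c)) (range c)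
    ≤⟨ ∑-mono (All.map (λ ∣a∣≤c → ℕₚ.+-mono-≤ (ℕₚ.*-monoʳ-≤ ℓ (ℕₚ.*-mono-≤ ∣a∣≤c ∣a∣≤c))
                                              (∑‖L‖₂²≤ n c))
                       (range-bounded c)) ⟩
  ∑ (λ _ → ℓ * (c * c) + ℓ * (n * (c * c))) (range c)
    ≡⟨ ∑-const _ (range c) ⟩
  length (range c) * (ℓ * (c * c) + ℓ * (n * (c * c)))
    ≡⟨ cong (length (range c) *_) (ℕₚ.*-distribˡ-+ ℓ (c * c) (n * (c * c))) ⟨
  length (range c) * (ℓ * (suc n * (c * c)))
    ≡⟨ ℕₚ.*-assoc (length (range c)) ℓ _ ⟨
  length (range c) * ℓ * (suc n * (c * c))
    ≡⟨ cong (_* (suc n * (c * c))) (length-pairs _∷_ (range c) (L n c)) ⟨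
  length (L (suc n) c) * (suc n * (c * c)) ∎
  where
  open ℕₚ.≤-Reasoning
  ℓ = length (L n c)

‖origin‖₂² : ∀ n → ‖ origin {n} ‖₂² ≡ 0
‖origin‖₂² zero    = refl
‖origin‖₂² (suc n) = ‖origin‖₂² n

∑‖walk‖₂²-suc : ∀ n c m →
  ∑ (λ w → ‖ position w ‖₂²) (stepSeqs n c (suc m))
    ≡ length (stepSeqs n c m) * ∑ ‖_‖₂² (L n c)
      + length (L n c) * ∑ (λ w → ‖ position w ‖₂²) (stepSeqs n c m)
∑‖walk‖₂²-suc n c m = begin
  ∑ (λ w → ‖ position w ‖₂²) (stepSeqs n c (suc m))
    ≡⟨ ∑-pairs (λ w → ‖ position w ‖₂²) _∷_ (L n c) W ⟩
  ∑ (λ s → ∑ (λ w → ‖ s ⊕ position w ‖₂²) W) (L n c)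
    ≡⟨ ∑-comm (λ s w → ‖ s ⊕ position w ‖₂²) (L n c) W ⟩
  ∑ (λ w → ∑ (λ s → ‖ s ⊕ position w ‖₂²) (L n c)) W
    ≡⟨ ∑-cong (λ w → ∑‖s⊕p‖₂² n c (position w)) W ⟩
  ∑ (λ w → ∑ ‖_‖₂² (L n c) + length (L n c) * ‖ position w ‖₂²) W
    ≡⟨ ∑-distrib-+ _ _ W ⟩
  ∑ (λ _ → ∑ ‖_‖₂² (L n c)) W + ∑ (λ w → length (L n c) * ‖ position w ‖₂²) W
    ≡⟨ cong₂ _+_ (∑-const _ W) (sym (∑-distribˡ-* (length (L n c)) _ W)) ⟩
  length W * ∑ ‖_‖₂² (L n c) + length (L n c) * ∑ (λ w → ‖ position w ‖₂²) W ∎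
  where
  open ≡-Reasoning
  W = stepSeqs n c m

∑‖walk‖₂²≤ : ∀ n c m →
  ∑ (λ w → ‖ position w ‖₂²) (stepSeqs n c m) ≤ m * (n * (c * c)) * length (stepSeqs n c m)
∑‖walk‖₂²≤ n c zero    = ℕₚ.≤-reflexive (trans (ℕₚ.+-identityʳ _) (‖origin‖₂² n))
∑‖walk‖₂²≤ n c (suc m) = begin
  ∑ (λ w → ‖ position w ‖₂²) (stepSeqs n c (suc m))
    ≡⟨ ∑‖walk‖₂²-suc n c m ⟩
  length W * ∑ ‖_‖₂² (L n c) + ℓ * ∑ (λ w → ‖ position w ‖₂²) W
    ≤⟨ ℕₚ.+-mono-≤ (ℕₚ.*-monoʳ-≤ (length W) (∑‖L‖₂²≤ n c)) (ℕₚ.*-monoʳ-≤ ℓ (∑‖walk‖₂²≤ n c m)) ⟩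
  length W * (ℓ * B) + ℓ * (m * B * length W)
    ≡⟨ regroup (length W) ℓ B m ⟩
  suc m * B * (ℓ * length W)
    ≡⟨ cong (suc m * B *_) (length-pairs _∷_ (L n c) W) ⟨
  suc m * B * length (stepSeqs n c (suc m)) ∎
  where
  open ℕₚ.≤-Reasoning
  W = stepSeqs n c m
  ℓ = length (L n c)
  B = n * (c * c)
  regroup : ∀ t l b m → t * (l * b) + l * (m * b * t) ≡ suc m * b * (l * t)
  regroup = ℕ-Solver.solve-∀

inner?≡false⇒k²≤‖‖₂² : ∀ {n} k (x : Vertex n) → inner? k x ≡ false → k * k ≤ ‖ x ‖₂²
inner?≡false⇒k²≤‖‖₂² k x outside = ℕₚ.≤-trans (ℕₚ.*-mono-≤ k≤‖x‖ k≤‖x‖) (‖‖²≤‖‖₂² x)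
  where
  k≤‖x‖ : k ≤ ‖ x ‖
  k≤‖x‖ = ℕₚ.≮⇒≥ (λ ‖x‖<k → subst T outside (ℕₚ.<⇒<ᵇ ‖x‖<k))

escape-bound : ∀ n c m k →
  k * k * length (stepSeqs n c m)
    ≤ k * k * count (λ w → inner? k (position w)) (stepSeqs n c m)
      + m * (n * (c * c)) * length (stepSeqs n c m)
escape-bound n c m k =
  ℕₚ.≤-trans (markov (λ w → inner? k (position w)) (λ w → ‖ position w ‖₂²) (k * k)
                    (λ w → inner?≡false⇒k²≤‖‖₂² k (position w)) (stepSeqs n c m))
            (ℕₚ.+-monoʳ-≤ _ (∑‖walk‖₂²≤ n c m))

-- Size of the hollow sphere

𝟙≤1 : ∀ b → 𝟙 b ≤ 1
𝟙≤1 true  = ℕₚ.≤-refl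
𝟙≤1 false = z≤n

𝟙-⊔ : ∀ k m n → 𝟙 (k ≤ᵇ m ⊔ n) ≤ 𝟙 (k ≤ᵇ m) + 𝟙 (k ≤ᵇ n)
𝟙-⊔ k m n with ℕₚ.≤-total m n
... | inj₁ m≤n rewrite ℕₚ.m≤n⇒m⊔n≡n m≤n = ℕₚ.m≤n+m _ _
... | inj₂ n≤m rewrite ℕₚ.m≥n⇒m⊔n≡m n≤m = ℕₚ.m≤m+n _ _

count-range-suc : ∀ (p : ℕ → Bool) r →
  count (λ a → p ∣ a ∣) (range (suc r)) ≡ 2 * 𝟙 (p (suc r)) + count (λ a → p ∣ a ∣) (range r)
count-range-suc p r = begin
  count (λ a → p ∣ a ∣) (range (suc r))
    ≡⟨ cong (count (λ a → p ∣ a ∣)) (range-suc r) ⟩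
  x + count (λ a → p ∣ a ∣) (range r ∷ʳ + suc r)
    ≡⟨ cong (_+_ x) (∑-++ (λ a → 𝟙 (p ∣ a ∣)) (range r) _) ⟩
  x + (count (λ a → p ∣ a ∣) (range r) + (x + 0))
    ≡⟨ regroup x _ ⟩
  2 * x + count (λ a → p ∣ a ∣) (range r) ∎
  where
  open ≡-Reasoning
  x = 𝟙 (p (suc r))
  regroup : ∀ x C → x + (C + (x + 0)) ≡ 2 * x + C
  regroup = ℕ-Solver.solve-∀

count-range-< : ∀ k r → r ℕ.< k → count (λ a → k ≤ᵇ ∣ a ∣) (range r) ≡ 0
count-range-< (suc k) zero    _   = refl
count-range-< k       (suc r) r<k = begin
  count (λ a → k ≤ᵇ ∣ a ∣) (range (suc r))
    ≡⟨ count-range-suc (k ≤ᵇ_) r ⟩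
  2 * 𝟙 (k ≤ᵇ suc r) + count (λ a → k ≤ᵇ ∣ a ∣) (range r)
    ≡⟨ cong₂ (λ b C → 2 * 𝟙 b + C) k≰ᵇ1+r (count-range-< k r (ℕₚ.<-trans (ℕₚ.n<1+n r) r<k)) ⟩
  0 ∎
  where
  open ≡-Reasoning
  k≰ᵇ1+r : (k ≤ᵇ suc r) ≡ false
  k≰ᵇ1+r with k ≤ᵇ suc r in eq
  ... | true  = contradiction (ℕₚ.≤ᵇ⇒≤ k (suc r) (subst T (sym eq) _)) (ℕₚ.<⇒≱ r<k)
  ... | false = refl

count-range≤ : ∀ k c → count (λ a → k ≤ᵇ ∣ a ∣) (range (k + c)) ≤ 2 * suc c
count-range≤ k zero rewrite ℕₚ.+-identityʳ k = sphere k
  where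
  sphere : ∀ k → count (λ a → k ≤ᵇ ∣ a ∣) (range k) ≤ 2
  sphere zero    = s≤s z≤n
  sphere (suc k) = begin
    count (λ a → suc k ≤ᵇ ∣ a ∣) (range (suc k))
      ≡⟨ count-range-suc (suc k ≤ᵇ_) k ⟩
    2 * 𝟙 (suc k ≤ᵇ suc k) + count (λ a → suc k ≤ᵇ ∣ a ∣) (range k)
      ≤⟨ ℕₚ.+-mono-≤ (ℕₚ.*-monoʳ-≤ 2 (𝟙≤1 (suc k ≤ᵇ suc k)))
                     (ℕₚ.≤-reflexive (count-range-< (suc k) k ℕₚ.≤-refl)) ⟩
    2 ∎
    where open ℕₚ.≤-Reasoning
count-range≤ k (suc c) rewrite ℕₚ.+-suc k c = begin
  count (λ a → k ≤ᵇ ∣ a ∣) (range (suc (k + c)))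
    ≡⟨ count-range-suc (k ≤ᵇ_) (k + c) ⟩
  2 * 𝟙 (k ≤ᵇ suc (k + c)) + count (λ a → k ≤ᵇ ∣ a ∣) (range (k + c))
    ≤⟨ ℕₚ.+-mono-≤ (ℕₚ.*-monoʳ-≤ 2 (𝟙≤1 (k ≤ᵇ suc (k + c)))) (count-range≤ k c) ⟩
  2 * 1 + 2 * suc c
    ≡⟨ ℕₚ.*-distribˡ-+ 2 1 (suc c) ⟨
  2 * suc (suc c) ∎
  where open ℕₚ.≤-Reasoning

count-L-suc≤ : ∀ n r k →
  count (λ x → k ≤ᵇ ‖ x ‖) (L (suc n) r)
    ≤ length (L n r) * count (λ a → k ≤ᵇ ∣ a ∣) (range r)
      + length (range r) * count (λ x → k ≤ᵇ ‖ x ‖) (L n r)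
count-L-suc≤ n r k = begin
  count (λ x → k ≤ᵇ ‖ x ‖) (L (suc n) r)
    ≡⟨ ∑-pairs (λ x → 𝟙 (k ≤ᵇ ‖ x ‖)) _∷_ (range r) (L n r) ⟩
  ∑ (λ a → ∑ (λ s → 𝟙 (k ≤ᵇ ∣ a ∣ ⊔ ‖ s ‖)) (L n r)) (range r)
    ≤⟨ ∑-mono (All.universal (λ a → ∑-mono (All.universal (λ s → 𝟙-⊔ k ∣ a ∣ ‖ s ‖) (L n r)))
                             (range r)) ⟩
  ∑ (λ a → ∑ (λ s → 𝟙 (k ≤ᵇ ∣ a ∣) + 𝟙 (k ≤ᵇ ‖ s ‖)) (L n r)) (range r)
    ≡⟨ ∑-cong (λ a → trans (∑-distrib-+ _ _ (L n r)) (cong (_+ C) (∑-const _ (L n r)))) (range r) ⟩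
  ∑ (λ a → ℓ * 𝟙 (k ≤ᵇ ∣ a ∣) + C) (range r)
    ≡⟨ ∑-distrib-+ (λ a → ℓ * 𝟙 (k ≤ᵇ ∣ a ∣)) (λ _ → C) (range r) ⟩
  ∑ (λ a → ℓ * 𝟙 (k ≤ᵇ ∣ a ∣)) (range r) + ∑ (λ _ → C) (range r)
    ≡⟨ cong₂ _+_ (sym (∑-distribˡ-* ℓ _ (range r))) (∑-const C (range r)) ⟩
  ℓ * count (λ a → k ≤ᵇ ∣ a ∣) (range r) + length (range r) * C ∎
  where
  open ℕₚ.≤-Reasoning
  ℓ = length (L n r)
  C = count (λ x → k ≤ᵇ ‖ x ‖) (L n r)

-- The inner radius is suc k so that the single point [] of L^0 is not counted.
count-hollow≤ : ∀ n k c →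
  count (λ x → suc k ≤ᵇ ‖ x ‖) (L (suc n) (suc k + c))
    ≤ suc n * (2 * suc c) * suc (suc k + c + (suc k + c)) ^ n
count-hollow≤ zero k c = begin
  count (λ x → suc k ≤ᵇ ‖ x ‖) (L 1 R)
    ≤⟨ count-L-suc≤ 0 R (suc k) ⟩
  1 * cr + length (range R) * 0
    ≡⟨ cong₂ _+_ (ℕₚ.*-identityˡ cr) (ℕₚ.*-zeroʳ (length (range R))) ⟩
  cr + 0
    ≡⟨ ℕₚ.+-identityʳ cr ⟩
  cr
    ≤⟨ count-range≤ (suc k) c ⟩
  2 * suc c
    ≡⟨ trans (ℕₚ.*-identityʳ (1 * (2 * suc c))) (ℕₚ.*-identityˡ (2 * suc c)) ⟨
  1 * (2 * suc c) * 1 ∎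
  where
  open ℕₚ.≤-Reasoning
  R = suc k + c
  cr = count (λ a → suc k ≤ᵇ ∣ a ∣) (range R)
count-hollow≤ (suc n) k c = begin
  count (λ x → suc k ≤ᵇ ‖ x ‖) (L (suc (suc n)) R)
    ≤⟨ count-L-suc≤ (suc n) R (suc k) ⟩
  length (L (suc n) R) * count (λ a → suc k ≤ᵇ ∣ a ∣) (range R)
    + length (range R) * count (λ x → suc k ≤ᵇ ‖ x ‖) (L (suc n) R)
    ≤⟨ ℕₚ.+-mono-≤ (ℕₚ.*-mono-≤ (ℕₚ.≤-reflexive (length-L (suc n) R)) (count-range≤ (suc k) c))
                   (ℕₚ.*-mono-≤ (ℕₚ.≤-reflexive (length-range R)) (count-hollow≤ n k c)) ⟩
  w ^ suc n * B + w * (suc n * B * w ^ n)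
    ≡⟨ regroup w (w ^ n) B n ⟩
  suc (suc n) * B * w ^ suc n ∎
  where
  open ℕₚ.≤-Reasoning
  R = suc k + c
  w = suc (R + R)
  B = 2 * suc c
  regroup : ∀ w p b n → w * p * b + w * (suc n * b * p) ≡ suc (suc n) * b * (w * p)
  regroup = ℕ-Solver.solve-∀

hollow-size≤ : ∀ n → n ≡ 1 ⊎ n ≡ 2 → ∀ k c →
               N n (suc k) c ≤ 2 * (2 * suc c) * suc (suc k + c + (suc k + c))
hollow-size≤ n n∈12 k c =
  ℕₚ.≤-trans (ℕₚ.≤-reflexive (length-filter (λ x → suc k ≤ᵇ ‖ x ‖) (L n (suc k + c)))) (bound n∈12)
  where
  B = 2 * suc c
  w = suc (suc k + c + (suc k + c))
  1≤w : 1 ≤ w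
  1≤w = s≤s z≤n
  bound : n ≡ 1 ⊎ n ≡ 2 → count (λ x → suc k ≤ᵇ ‖ x ‖) (L n (suc k + c)) ≤ 2 * B * w
  bound (inj₁ refl) =
    ℕₚ.≤-trans (count-hollow≤ 0 k c) (ℕₚ.*-mono-≤ (ℕₚ.*-monoˡ-≤ B (ℕₚ.n≤1+n 1)) 1≤w)
  bound (inj₂ refl) =
    ℕₚ.≤-trans (count-hollow≤ 1 k c) (ℕₚ.≤-reflexive (cong (2 * B *_) (ℕₚ.*-identityʳ w)))

-- Choosing k, and passing to ℚ

linear<square : ∀ a c k → 4 * a + c ℕ.< k → a * suc (k + c + (k + c)) ℕ.< k * k
linear<square a c k@(suc _) 4a+c<k = begin-strict
  a * suc (k + c + (k + c))   ≤⟨ ℕₚ.*-monoʳ-≤ a w≤4k ⟩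
  a * (4 * k)                 ≡⟨ ℕₚ.*-assoc a 4 k ⟨
  a * 4 * k                   ≡⟨ cong (_* k) (ℕₚ.*-comm a 4) ⟩
  4 * a * k                   <⟨ ℕₚ.*-monoˡ-< k (ℕₚ.≤-<-trans (ℕₚ.m≤m+n (4 * a) c) 4a+c<k) ⟩
  k * k                       ∎
  where
  open ℕₚ.≤-Reasoning
  twice-suc : ∀ k c → suc (suc (k + c + (k + c))) ≡ 2 * (k + suc c)
  twice-suc = ℕ-Solver.solve-∀
  twice-double : ∀ k → 2 * (k + k) ≡ 4 * k
  twice-double = ℕ-Solver.solve-∀
  c<k : c ℕ.< k
  c<k = ℕₚ.≤-trans (s≤s (ℕₚ.m≤n+m c (4 * a))) 4a+c<k
  w≤4k : suc (k + c + (k + c)) ≤ 4 * k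
  w≤4k = begin
    suc (k + c + (k + c))       ≤⟨ ℕₚ.n≤1+n _ ⟩
    suc (suc (k + c + (k + c))) ≡⟨ twice-suc k c ⟩
    2 * (k + suc c)             ≤⟨ ℕₚ.*-monoʳ-≤ 2 (ℕₚ.+-monoʳ-≤ k c<k) ⟩
    2 * (k + k)                 ≡⟨ twice-double k ⟩
    4 * k                       ∎

escape-fraction< : ∀ {K T a E q} p → K * T ≤ K * a + E * T → q * E ℕ.< K → 0 ℕ.< T →
                   q * T ℕ.< q * a + suc p * T
escape-fraction< {K} {T} {a} {E} {q} p KT≤Ka+ET qE<K T>0 = ℕₚ.*-cancelˡ-< K _ _ (begin-strict
  K * (q * T)
    ≡⟨ left-comm K q T ⟩
  q * (K * T)
    ≤⟨ ℕₚ.*-monoʳ-≤ q KT≤Ka+ET ⟩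
  q * (K * a + E * T)
    ≡⟨ distribute q K a E T ⟩
  K * (q * a) + q * E * T
    <⟨ ℕₚ.+-monoʳ-< (K * (q * a)) (ℕₚ.*-monoˡ-< T {{ℕ.>-nonZero T>0}} qE<K) ⟩
  K * (q * a) + K * T
    ≤⟨ ℕₚ.+-monoʳ-≤ (K * (q * a)) (ℕₚ.*-monoʳ-≤ K (ℕₚ.m≤m+n T (p * T))) ⟩
  K * (q * a) + K * (suc p * T)
    ≡⟨ ℕₚ.*-distribˡ-+ K (q * a) (suc p * T) ⟨
  K * (q * a + suc p * T) ∎)
  where
  open ℕₚ.≤-Reasoning
  left-comm : ∀ K q T → K * (q * T) ≡ q * (K * T)
  left-comm = ℕ-Solver.solve-∀
  distribute : ∀ q K a E T → q * (K * a + E * T) ≡ K * (q * a) + q * E * T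
  distribute = ℕ-Solver.solve-∀

caged-fraction : ∀ n → n ≡ 1 ⊎ n ≡ 2 → ∀ c q p → ∃[ k ]
  (suc q * suc (c + c) ^ (n * N n k c)
     ℕ.< suc q * countA n k c + suc p * suc (c + c) ^ (n * N n k c))
caged-fraction n n∈12 c q p =
  k , escape-fraction< {k * k} {suc (c + c) ^ (n * m)} {countA n k c} {E} {suc q} p
                       escape qE<k² (ℕₚ.m^n>0 (suc (c + c)) (n * m))
  where
  a = suc q * (2 * (2 * suc c)) * (2 * (c * c))
  k = suc (4 * a + c)
  m = N n k c
  W = stepSeqs n c m
  E = m * (n * (c * c))
  open ℕₚ.≤-Reasoning
  regroup : ∀ q c w → suc q * (2 * (2 * suc c) * w * (2 * (c * c)))
                      ≡ suc q * (2 * (2 * suc c)) * (2 * (c * c)) * w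
  regroup = ℕ-Solver.solve-∀
  n≤2 : n ≡ 1 ⊎ n ≡ 2 → n ≤ 2
  n≤2 (inj₁ refl) = ℕₚ.n≤1+n 1
  n≤2 (inj₂ refl) = ℕₚ.≤-refl
  escape : k * k * suc (c + c) ^ (n * m) ≤ k * k * countA n k c + E * suc (c + c) ^ (n * m)
  escape = begin
    k * k * suc (c + c) ^ (n * m)
      ≡⟨ cong (k * k *_) (length-stepSeqs n c m) ⟨
    k * k * length W
      ≤⟨ escape-bound n c m k ⟩
    k * k * count (λ w → inner? k (position w)) W + E * length W
      ≡⟨ cong₂ (λ x y → k * k * x + E * y) (sym (length-filter (λ w → inner? k (position w)) W))
                                           (length-stepSeqs n c m) ⟩
    k * k * countA n k c + E * suc (c + c) ^ (n * m) ∎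
  qE<k² : suc q * E ℕ.< k * k
  qE<k² = begin-strict
    suc q * E
      ≤⟨ ℕₚ.*-monoʳ-≤ (suc q) (ℕₚ.*-mono-≤ (hollow-size≤ n n∈12 (4 * a + c) c)
                                            (ℕₚ.*-monoˡ-≤ (c * c) (n≤2 n∈12))) ⟩
    suc q * (2 * (2 * suc c) * suc (k + c + (k + c)) * (2 * (c * c)))
      ≡⟨ regroup q c _ ⟩
    a * suc (k + c + (k + c))
      <⟨ linear<square a c k ℕₚ.≤-refl ⟩
    k * k ∎

1-p/q<a/D : ∀ p q a D .{{_ : ℕ.NonZero D}} .(cop : Coprime (suc p) (suc q)) →
            suc q * D ℕ.< suc q * a + suc p * D → 1ℚ - mkℚ +[1+ p ] q cop < + a / D
1-p/q<a/D p q a (suc D) cop qD<qa+pD =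
  ℚₚ.toℚᵘ-cancel-< (ℚᵘₚ.<-respˡ-≃ (ℚᵘₚ.≃-sym 1-ε≃)
                   (ℚᵘₚ.<-respʳ-≃ (ℚᵘₚ.≃-sym (ℚₚ.toℚᵘ-fromℚᵘ (mkℚᵘ (+ a) D)))
                   (ℚᵘ.*<* cross)))
  where
  ε = mkℚ +[1+ p ] q cop
  1-ε≃ : toℚᵘ (1ℚ - ε) ℚᵘ.≃ toℚᵘ 1ℚ ℚᵘ.+ ℚᵘ.- mkℚᵘ +[1+ p ] q
  1-ε≃ = ℚᵘₚ.≃-trans (ℚₚ.toℚᵘ-homo-+ 1ℚ (ℚ.- ε)) (ℚᵘₚ.+-congʳ (toℚᵘ 1ℚ) (ℚₚ.toℚᵘ-homo‿- ε))
  cast : + suc q ℤ.* + suc D ℤ.< + suc q ℤ.* + a ℤ.+ + suc p ℤ.* + suc D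
  cast = subst₂ ℤ._<_ (ℤₚ.pos-* (suc q) (suc D))
                      (trans (ℤₚ.pos-+ (suc q * a) (suc p * suc D))
                             (cong₂ ℤ._+_ (ℤₚ.pos-* (suc q) a) (ℤₚ.pos-* (suc p) (suc D))))
                      (ℤ.+<+ qD<qa+pD)
  lhs : ∀ q p D → q ℤ.* D ℤ.+ ℤ.- (p ℤ.* D) ≡ (+ 1 ℤ.* q ℤ.+ ℤ.- p ℤ.* + 1) ℤ.* D
  lhs = solve-∀
  rhs : ∀ q p D a → q ℤ.* a ℤ.+ p ℤ.* D ℤ.+ ℤ.- (p ℤ.* D) ≡ a ℤ.* (+ 1 ℤ.* q)
  rhs = solve-∀
  -- The claim with denominators cleared, in the shape ℚᵘ's _+_ and _<_ unfold to.
  cross : (+ 1 ℤ.* + suc q ℤ.+ ℤ.- +[1+ p ] ℤ.* + 1) ℤ.* + suc D ℤ.< + a ℤ.* (+ 1 ℤ.* + suc q)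
  cross = subst₂ ℤ._<_ (lhs (+ suc q) (+ suc p) (+ suc D)) (rhs (+ suc q) (+ suc p) (+ suc D) (+ a))
                 (ℤₚ.+-monoˡ-< (ℤ.- (+ suc p ℤ.* + suc D)) cast)

theorem2 : (n : ℕ) → n ≡ 1 ⊎ n ≡ 2 → (c : ℕ) → (ε : ℚ) → 0ℚ < ε →
             ∃[ k ] (1ℚ - ε < ProbA n k c)
theorem2 n n∈12 c (mkℚ +[1+ p ] q cop) _ =
  let k , caged = caged-fraction n n∈12 c q p
      D = suc (c + c) ^ (n * N n k c)
  in k , 1-p/q<a/D p q (countA n k c) D {{ℕₚ.m^n≢0 (suc (c + c)) (n * N n k c)}} cop caged
theorem2 n n∈12 c (mkℚ (+ 0) q _) (ℚ.*<* (ℤ.+<+ ()))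
theorem2 n n∈12 c (mkℚ -[1+ _ ] q _) (ℚ.*<* ())
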